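{- Let $G=(X,Y,E)$ be a chain graph without isolated vertices, with a chain partition of length $k$. Then (a) $\chi_{td}(G)=2$ if and only if $k=1$; (b) $\chi_{td}(G)=3$ if and only if $k=2$; (c) $\chi_{td}(G)=4$ if and only if $k\ge 3$.
   Context: A bipartite graph $G=(X,Y,E)$ (parts $X,Y$ independent) is a chain graph if the vertices of $X$ can be ordered $x_1,\dots,x_{n_1}$ with $N(x_1)\subseteq N(x_2)\subseteq\cdots\subseteq N(x_{n_1})$. Its chain partition is obtained as follows: partition $X$ into classes $X_1,\dots,X_k$ of vertices with equal neighbourhoods, indexed so that $N(X_1)\subsetneq N(X_2)\subsetneq\cdots\subsetneq N(X_k)$; set $Y_1=N(X_1)$ and $Y_i=N(X_i)\setminus\bigcup_{j<i}N(X_j)$ for $2\le i\le k$; $k$ is the length of the chain partition. A total dominator coloring (TD-coloring) is a proper vertex coloring in which every vertex is adjacent to all vertices of some color class; $\chi_{td}(G)$ is the minimum number of colors of a TD-coloring. -}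

module Defs where

open import Data.Nat using (ℕ; _≤_; _<_)
open import Data.Fin using (Fin; toℕ)
open import Data.Bool using (Bool; true)
open import Data.Sum using (_⊎_; inj₁; inj₂)
open import Data.Product using (Σ; ∃; _×_)
open import Data.Empty using (⊥)
open import Function.Definitions using (Injective; Surjective)
open import Relation.Binary.PropositionalEquality using (_≡_)
open import Relation.Nullary using (¬_)
open import Function.Bundles using (_⇔_)

-- A bipartite graph G = (X, Y, E) with X = Fin n₁, Y = Fin n₂;
-- x ∈ X and y ∈ Y are adjacent iff E x y ≡ true. Parts are independent.
BipGraph : ℕ → ℕ → Set
BipGraph n₁ n₂ = Fin n₁ → Fin n₂ → Bool

module _ {n₁ n₂ : ℕ} (E : BipGraph n₁ n₂) where

  V : Set
  V = Fin n₁ ⊎ Fin n₂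

  Adj : V → V → Set
  Adj (inj₁ x) (inj₂ y) = E x y ≡ true
  Adj (inj₂ y) (inj₁ x) = E x y ≡ true
  Adj (inj₁ _) (inj₁ _) = ⊥
  Adj (inj₂ _) (inj₂ _) = ⊥

  NSub : Fin n₁ → Fin n₁ → Set
  NSub x x' = ∀ y → E x y ≡ true → E x' y ≡ true

  NEq : Fin n₁ → Fin n₁ → Set
  NEq x x' = NSub x x' × NSub x' x

  IsChainGraph : Set
  IsChainGraph =
    Σ (Fin n₁ → Fin n₁) λ σ →
      Injective _≡_ _≡_ σ ×
      (∀ i j → toℕ i ≤ toℕ j → NSub (σ i) (σ j))

  NoIsolated : Set
  NoIsolated = (∀ v → ∃ λ u → Adj v u)

  -- G has a chain partition of length k: X is partitioned into k
  -- nonempty classes X₁,…,X_k (class of x is cls x) of vertices with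
  -- equal neighbourhoods, indexed so that N(X₁) ⊊ N(X₂) ⊊ ⋯ ⊊ N(X_k).
  -- (Strictness follows from distinct classes having distinct
  -- neighbourhoods.) The sets Y_i are determined by the X_i.
  ChainPartition : ℕ → Set
  ChainPartition k =
    Σ (Fin n₁ → Fin k) λ cls →
      Surjective _≡_ _≡_ cls ×
      (∀ x x' → (cls x ≡ cls x') ⇔ NEq x x') ×
      (∀ x x' → toℕ (cls x) ≤ toℕ (cls x') → NSub x x')

  IsTDColoring : (m : ℕ) → (V → Fin m) → Set
  IsTDColoring m c =
    (∀ u v → Adj u v → ¬ (c u ≡ c v)) ×
    (∀ v → ∃ λ i → (∃ λ w → c w ≡ i) × (∀ u → c u ≡ i → Adj v u))

  HasTDColoring : ℕ → Set
  HasTDColoring m = ∃ λ (c : V → Fin m) → IsTDColoring m c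

  χtd≡ : ℕ → Set
  χtd≡ m = HasTDColoring m × (∀ m' → m' < m → ¬ HasTDColoring m')

-- In a chain graph with classes X₁, …, X_k, every neighbour of X₁ is adjacent to all of X and
-- every vertex of X_k to all of Y, so these two sets can serve as the classes that X-vertices and
-- Y-vertices dominate. Giving X_k, N(X₁), the rest of X and the rest of Y one colour each is a
-- TD-coloring; for k = 2 the last two can share a colour, and for k = 1 they are empty.
-- Conversely, a TD-coloring is refuted by exhibiting more pairwise distinct colours than there
-- are: if x₂ has a neighbour y₂ outside N(x₁), then the class dominated by x₁, c(x₂) and c(y₂)
-- are distinct, and if moreover x₂ misses some y₃, the class dominated by y₃ is a fourth one.
-- Vertices of X₁, X₂, X₃ provide these configurations when k ≥ 2, resp. k ≥ 3.
module Submission where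

open import Defs
open import Data.Nat using (ℕ; zero; suc; _+_; _≤_; _<_; z≤n; s≤s; s≤s⁻¹)
open import Data.Nat.Properties using (<-cmp; 1+n≰n; <-irrefl; <⇒≤)
open import Data.Fin using (Fin; toℕ; inject₁; inject≤; fromℕ; #_) renaming (zero to fzero; suc to fsuc)
open import Data.Fin.Properties using (injective⇒≤; inject≤-injective; inject₁-injective; fromℕ≢inject₁; ¬Fin0; any?; ≤fromℕ; _≟_)
open import Data.Bool using (Bool; true; false; if_then_else_)
open import Data.Bool.Properties using (not-¬) renaming (_≟_ to _≟ᵇ_)
open import Data.Vec using (Vec; []; _∷_)
open import Data.Vec.Relation.Unary.All using ([]; _∷_)
open import Data.Vec.Relation.Unary.Unique.Propositional using (Unique; []; _∷_)
open import Data.Vec.Relation.Unary.Unique.Propositional.Properties using (lookup-injective)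
open import Data.Product using (_×_; _,_; proj₁; proj₂; ∃)
open import Data.Sum using (inj₁; inj₂; [_,_])
open import Data.Empty using (⊥; ⊥-elim)
open import Function using (_∘_)
open import Function.Definitions using (Injective)
open import Relation.Nullary using (¬_; yes; no; does; contradiction)
open import Relation.Nullary.Decidable using (_×-dec_)
open import Relation.Binary using (tri<; tri≈; tri>)
open import Relation.Binary.PropositionalEquality using (_≡_; _≢_; refl; sym; trans; subst; subst₂; cong; module ≡-Reasoning)
open import Function.Bundles using (_⇔_; mk⇔; Equivalence)
open import Function.Properties.Equivalence using () renaming (trans to ⇔-trans)

Unique⇒length≤ : ∀ {m n} {xs : Vec (Fin m) n} → Unique xs → n ≤ m
Unique⇒length≤ xs! = injective⇒≤ (lookup-injective xs! _ _)

module _ {n₁ n₂ : ℕ} (E : BipGraph n₁ n₂) where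

  Proper : ∀ {m} → (V E → Fin m) → Set
  Proper c = ∀ u v → Adj E u v → c u ≢ c v

  Dominates : ∀ {m} → (V E → Fin m) → V E → Fin m → Set
  Dominates c v i = (∃ λ w → c w ≡ i) × (∀ u → c u ≡ i → Adj E v u)

  no-common-neighbour : ∀ x y w → Adj E (inj₁ x) w → Adj E (inj₂ y) w → ⊥
  no-common-neighbour x y (inj₁ _) ()
  no-common-neighbour x y (inj₂ _) _ ()

  neighbourʸ : NoIsolated E → ∀ x → ∃ λ y → E x y ≡ true
  neighbourʸ no-isolated x with no-isolated (inj₁ x)
  ... | inj₂ y , xy = y , xy

  neighbourˣ : NoIsolated E → ∀ y → ∃ λ x → E x y ≡ true
  neighbourˣ no-isolated y with no-isolated (inj₂ y)
  ... | inj₁ x , xy = x , xy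

  ¬NSub⇒witness : ∀ x x′ → ¬ NSub E x x′ → ∃ λ y → E x y ≡ true × ¬ E x′ y ≡ true
  ¬NSub⇒witness x x′ x⊈x′ with any? (λ y → (E x y ≟ᵇ true) ×-dec (E x′ y ≟ᵇ false))
  ... | yes (y , xy , x′y≡false) = y , xy , λ x′y → not-¬ x′y x′y≡false
  ... | no ∄witness = contradiction x⊆x′ x⊈x′
    where
    x⊆x′ : NSub E x x′
    x⊆x′ y xy with E x′ y in x′y
    ... | true  = refl
    ... | false = contradiction (y , xy , x′y) ∄witness

  module _ {m} {c : V E → Fin m} where

    dominated-class-avoids : ∀ {v u i} → Dominates c v i → ¬ Adj E v u → i ≢ c u
    dominated-class-avoids {u = u} (_ , dom) ¬vu i≡cu = ¬vu (dom u (sym i≡cu))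

    dominated-classes-distinct : ∀ {x y i j} → Dominates c (inj₁ x) i → Dominates c (inj₂ y) j → i ≢ j
    dominated-classes-distinct {x} {y} ((w , cw≡i) , domx) (_ , domy) refl =
      no-common-neighbour x y w (domx w cw≡i) (domy w cw≡i)

  module _ {m m′} (f : Fin m → Fin m′) (f-injective : Injective _≡_ _≡_ f) where

    IsTDColoring-map : ∀ {c} → IsTDColoring E m c → IsTDColoring E m′ (f ∘ c)
    IsTDColoring-map (proper , dominated) =
      (λ u v uv → proper u v uv ∘ f-injective) ,
      λ v → let (i , (w , cw≡i) , dom) = dominated v in
            f i , (w , cong f cw≡i) , λ u fcu≡fi → dom u (f-injective fcu≡fi)

  HasTDColoring-mono : ∀ {m m′} → m ≤ m′ → HasTDColoring E m → HasTDColoring E m′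
  HasTDColoring-mono m≤m′ (c , td) =
    _ , IsTDColoring-map (λ i → inject≤ i m≤m′) (inject≤-injective _ _ _ _) td

  χtd≡-unique : ∀ {m m′} → χtd≡ E m → χtd≡ E m′ → m ≡ m′
  χtd≡-unique {m} {m′} (has , min) (has′ , min′) with <-cmp m m′
  ... | tri< m<m′ _ _ = contradiction has (min′ m m<m′)
  ... | tri≈ _ m≡m′ _ = m≡m′
  ... | tri> _ _ m′<m = contradiction has′ (min m′ m′<m)

  χtd≡-intro : ∀ {m} → HasTDColoring E (suc m) → ¬ HasTDColoring E m → χtd≡ E (suc m)
  χtd≡-intro has ¬has = has , λ m′ m′<1+m → ¬has ∘ HasTDColoring-mono (s≤s⁻¹ m′<1+m)

  edge⇒¬TD1 : ∀ {x y} → E x y ≡ true → ¬ HasTDColoring E 1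
  edge⇒¬TD1 {x} {y} xy (c , proper , _) =
    1+n≰n (Unique⇒length≤ {xs = c (inj₁ x) ∷ c (inj₂ y) ∷ []} ((proper _ _ xy ∷ []) ∷ [] ∷ []))

  private-neighbour⇒¬TD2 : ∀ {x₁ x₂ y} → E x₂ y ≡ true → ¬ E x₁ y ≡ true → ¬ HasTDColoring E 2
  private-neighbour⇒¬TD2 {x₁} {x₂} {y} x₂y ¬x₁y (c , proper , dominated) =
    1+n≰n (Unique⇒length≤ {xs = i ∷ c (inj₁ x₂) ∷ c (inj₂ y) ∷ []}
      ((avoids (λ ()) ∷ avoids ¬x₁y ∷ []) ∷ (proper _ _ x₂y ∷ []) ∷ [] ∷ []))
    where
    i : Fin 2
    i = proj₁ (dominated (inj₁ x₁))
    avoids : ∀ {u} → ¬ Adj E (inj₁ x₁) u → i ≢ c u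
    avoids = dominated-class-avoids (proj₂ (dominated (inj₁ x₁)))

  private-neighbour∧non-neighbour⇒¬TD3 :
    ∀ {x₁ x₂ y₂ y₃} → E x₂ y₂ ≡ true → ¬ E x₁ y₂ ≡ true → ¬ E x₂ y₃ ≡ true → ¬ HasTDColoring E 3
  private-neighbour∧non-neighbour⇒¬TD3 {x₁} {x₂} {y₂} {y₃} x₂y₂ ¬x₁y₂ ¬x₂y₃
                                        (c , proper , dominated) =
    1+n≰n (Unique⇒length≤ {xs = i ∷ j ∷ c (inj₁ x₂) ∷ c (inj₂ y₂) ∷ []}
      ((dominated-classes-distinct Di Dj ∷ avoidsᵢ (λ ()) ∷ avoidsᵢ ¬x₁y₂ ∷ []) ∷
       (avoidsⱼ ¬x₂y₃ ∷ avoidsⱼ (λ ()) ∷ []) ∷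
       (proper _ _ x₂y₂ ∷ []) ∷ [] ∷ []))
    where
    i j : Fin 3
    i = proj₁ (dominated (inj₁ x₁))
    j = proj₁ (dominated (inj₂ y₃))
    Di : Dominates c (inj₁ x₁) i
    Di = proj₂ (dominated (inj₁ x₁))
    Dj : Dominates c (inj₂ y₃) j
    Dj = proj₂ (dominated (inj₂ y₃))
    avoidsᵢ : ∀ {u} → ¬ Adj E (inj₁ x₁) u → i ≢ c u
    avoidsᵢ = dominated-class-avoids Di
    avoidsⱼ : ∀ {u} → ¬ Adj E (inj₂ y₃) u → j ≢ c u
    avoidsⱼ = dominated-class-avoids Dj

  bipartite-proper : ∀ {m} (f : Fin n₁ → Fin m) (g : Fin n₂ → Fin m) →
                     (∀ x y → E x y ≡ true → f x ≢ g y) → Proper [ f , g ]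
  bipartite-proper f g f≢g (inj₁ x) (inj₂ y) xy = f≢g x y xy
  bipartite-proper f g f≢g (inj₂ y) (inj₁ x) xy = f≢g x y xy ∘ sym

  joined-classes⇒IsTDColoring :
    ∀ {m} {c : V E → Fin m} → Proper c → (α β : Fin m) →
    (∃ λ w → c w ≡ α) → (∀ u → c u ≡ α → ∀ x → Adj E (inj₁ x) u) →
    (∃ λ w → c w ≡ β) → (∀ u → c u ≡ β → ∀ y → Adj E (inj₂ y) u) →
    IsTDColoring E m c
  joined-classes⇒IsTDColoring proper α β α-inhabited α-joined β-inhabited β-joined =
    proper ,
    λ { (inj₁ x) → α , α-inhabited , λ u cu≡α → α-joined u cu≡α x
      ; (inj₂ y) → β , β-inhabited , λ u cu≡β → β-joined u cu≡β y }

  complete⇒TD2 : Fin n₁ → Fin n₂ → (∀ x y → E x y ≡ true) → HasTDColoring E 2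
  complete⇒TD2 x₀ y₀ complete =
    c , joined-classes⇒IsTDColoring (bipartite-proper _ _ λ _ _ _ ())
          (# 1) (# 0)
          (inj₂ y₀ , refl) (λ { (inj₁ _) () ; (inj₂ y) _ x → complete x y })
          (inj₁ x₀ , refl) (λ { (inj₁ x) _ y → complete x y ; (inj₂ _) () })
    where
    c : V E → Fin 2
    c = [ (λ _ → # 0) , (λ _ → # 1) ]

  universal-pair⇒TD4 : ∀ a b → (∀ y → E a y ≡ true) → (∀ x → E x b ≡ true) → HasTDColoring E 4
  universal-pair⇒TD4 a b a-universal b-universal =
    c , joined-classes⇒IsTDColoring (bipartite-proper f g λ x y _ → f≢g x y)
          (# 2) (# 0) (inj₂ b , g-at-b) b-class-joined (inj₁ a , f-at-a) a-class-joined
    where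
    f : Fin n₁ → Fin 4
    f x = if does (x ≟ a) then # 0 else # 1
    g : Fin n₂ → Fin 4
    g y = if does (y ≟ b) then # 2 else # 3
    c : V E → Fin 4
    c = [ f , g ]
    f≢g : ∀ x y → f x ≢ g y
    f≢g x y with does (x ≟ a) | does (y ≟ b)
    ... | true  | true  = λ ()
    ... | true  | false = λ ()
    ... | false | true  = λ ()
    ... | false | false = λ ()
    f-at-a : f a ≡ # 0
    f-at-a with a ≟ a
    ... | yes _   = refl
    ... | no a≢a = contradiction refl a≢a
    g-at-b : g b ≡ # 2
    g-at-b with b ≟ b
    ... | yes _   = refl
    ... | no b≢b = contradiction refl b≢b
    f≡0⇒a : ∀ x → f x ≡ # 0 → x ≡ a
    f≡0⇒a x with x ≟ a
    ... | yes x≡a = λ _ → x≡a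
    ... | no _    = λ ()
    g≡2⇒b : ∀ y → g y ≡ # 2 → y ≡ b
    g≡2⇒b y with y ≟ b
    ... | yes y≡b = λ _ → y≡b
    ... | no _    = λ ()
    b-class-joined : ∀ u → c u ≡ # 2 → ∀ x → Adj E (inj₁ x) u
    b-class-joined (inj₁ x′) fx′≡2 = ⊥-elim (f≢g x′ b (trans fx′≡2 (sym g-at-b)))
    b-class-joined (inj₂ y)  gy≡2 x with g≡2⇒b y gy≡2
    ... | refl = b-universal x
    a-class-joined : ∀ u → c u ≡ # 0 → ∀ y → Adj E (inj₂ y) u
    a-class-joined (inj₁ x) fx≡0 y with f≡0⇒a x fx≡0
    ... | refl = a-universal y
    a-class-joined (inj₂ y′) gy′≡0 = ⊥-elim (f≢g a y′ (trans f-at-a (sym gy′≡0)))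

module ChainPartitionProperties {n₁ n₂ : ℕ} {E : BipGraph n₁ n₂} (no-isolated : NoIsolated E)
                                {k : ℕ} (P : ChainPartition E (suc k)) where

  cls : Fin n₁ → Fin (suc k)
  cls = proj₁ P

  rep : Fin (suc k) → Fin n₁
  rep j = proj₁ (proj₁ (proj₂ P) j)

  cls-rep : ∀ j → cls (rep j) ≡ j
  cls-rep j = proj₂ (proj₁ (proj₂ P) j) refl

  cls-monotone : ∀ x x′ → toℕ (cls x) ≤ toℕ (cls x′) → NSub E x x′
  cls-monotone = proj₂ (proj₂ (proj₂ P))

  NEq⇒cls≡ : ∀ x x′ → NEq E x x′ → cls x ≡ cls x′
  NEq⇒cls≡ x x′ = Equivalence.from (proj₁ (proj₂ (proj₂ P)) x x′)

  cls≡⇒⊆ : ∀ {x x′} → cls x ≡ cls x′ → NSub E x x′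
  cls≡⇒⊆ {x} {x′} = proj₁ ∘ Equivalence.to (proj₁ (proj₂ (proj₂ P)) x x′)

  rep-⊆ : ∀ {i j} → toℕ i ≤ toℕ j → NSub E (rep i) (rep j)
  rep-⊆ {i} {j} i≤j =
    cls-monotone (rep i) (rep j)
      (subst₂ (λ a b → toℕ a ≤ toℕ b) (sym (cls-rep i)) (sym (cls-rep j)) i≤j)

  rep-⊉ : ∀ {i j} → toℕ i < toℕ j → ∃ λ y → E (rep j) y ≡ true × ¬ E (rep i) y ≡ true
  rep-⊉ {i} {j} i<j = ¬NSub⇒witness E (rep j) (rep i) λ j⊆i →
    <-irrefl (cong toℕ (i≡j j⊆i)) i<j
    where
    open ≡-Reasoning
    i≡j : NSub E (rep j) (rep i) → i ≡ j
    i≡j j⊆i = begin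
      i              ≡⟨ sym (cls-rep i) ⟩
      cls (rep i)    ≡⟨ NEq⇒cls≡ (rep i) (rep j) (rep-⊆ (<⇒≤ i<j) , j⊆i) ⟩
      cls (rep j)    ≡⟨ cls-rep j ⟩
      j              ∎

  bottom-neighbours-universal : ∀ {y} → E (rep fzero) y ≡ true → ∀ x → E x y ≡ true
  bottom-neighbours-universal {y} x⊥y x =
    cls-monotone (rep fzero) x
      (subst (λ a → toℕ a ≤ toℕ (cls x)) (sym (cls-rep fzero)) z≤n) y x⊥y

  top-universal : ∀ {x} → cls x ≡ fromℕ k → ∀ y → E x y ≡ true
  top-universal {x} cls-x≡top y =
    cls-monotone x′ x
      (subst (λ a → toℕ (cls x′) ≤ toℕ a) (sym cls-x≡top) (≤fromℕ (cls x′))) y x′y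
    where
    x′ : Fin n₁
    x′ = proj₁ (neighbourˣ E no-isolated y)
    x′y : E x′ y ≡ true
    x′y = proj₂ (neighbourˣ E no-isolated y)

  x⊥ : Fin n₁
  x⊥ = rep fzero

  y⊥ : Fin n₂
  y⊥ = proj₁ (neighbourʸ E no-isolated x⊥)

  x⊥y⊥ : E x⊥ y⊥ ≡ true
  x⊥y⊥ = proj₂ (neighbourʸ E no-isolated x⊥)

  ¬TD1 : ¬ HasTDColoring E 1
  ¬TD1 = edge⇒¬TD1 E x⊥y⊥

  TD4 : HasTDColoring E 4
  TD4 = universal-pair⇒TD4 E (rep (fromℕ k)) y⊥ (top-universal (cls-rep (fromℕ k)))
          (bottom-neighbours-universal x⊥y⊥)

chain-χtd : ℕ → ℕ
chain-χtd zero                = 0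
chain-χtd (suc zero)          = 2
chain-χtd (suc (suc zero))    = 3
chain-χtd (suc (suc (suc _))) = 4

chain-χtd≡2⇔ : ∀ k → chain-χtd k ≡ 2 ⇔ k ≡ 1
chain-χtd≡2⇔ zero                = mk⇔ (λ ()) (λ ())
chain-χtd≡2⇔ (suc zero)          = mk⇔ (λ _ → refl) (λ _ → refl)
chain-χtd≡2⇔ (suc (suc zero))    = mk⇔ (λ ()) (λ ())
chain-χtd≡2⇔ (suc (suc (suc _))) = mk⇔ (λ ()) (λ ())

chain-χtd≡3⇔ : ∀ k → chain-χtd k ≡ 3 ⇔ k ≡ 2
chain-χtd≡3⇔ zero                = mk⇔ (λ ()) (λ ())
chain-χtd≡3⇔ (suc zero)          = mk⇔ (λ ()) (λ ())
chain-χtd≡3⇔ (suc (suc zero))    = mk⇔ (λ _ → refl) (λ _ → refl)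
chain-χtd≡3⇔ (suc (suc (suc _))) = mk⇔ (λ ()) (λ ())

chain-χtd≡4⇔ : ∀ k → chain-χtd k ≡ 4 ⇔ 3 ≤ k
chain-χtd≡4⇔ zero                = mk⇔ (λ ()) (λ ())
chain-χtd≡4⇔ (suc zero)          = mk⇔ (λ ()) (λ { (s≤s ()) })
chain-χtd≡4⇔ (suc (suc zero))    = mk⇔ (λ ()) (λ { (s≤s (s≤s ())) })
chain-χtd≡4⇔ (suc (suc (suc _))) = mk⇔ (λ _ → s≤s (s≤s (s≤s z≤n))) (λ _ → refl)

module _ {n₁ n₂ : ℕ} {E : BipGraph n₁ n₂} (no-isolated : NoIsolated E) where

  chain-length0⇒TD0 : ChainPartition E 0 → HasTDColoring E 0
  chain-length0⇒TD0 (cls , _) = c , (λ u → ⊥-elim (¬Fin0 (c u))) , λ v → ⊥-elim (¬Fin0 (c v))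
    where
    c : V E → Fin 0
    c = [ cls , cls ∘ proj₁ ∘ neighbourˣ E no-isolated ]

  chain-length1⇒TD2 : ChainPartition E 1 → HasTDColoring E 2
  chain-length1⇒TD2 P = complete⇒TD2 E x⊥ y⊥ complete
    where
    open ChainPartitionProperties no-isolated P
    complete : ∀ x y → E x y ≡ true
    complete x with cls x in cls-x
    ... | fzero = top-universal cls-x

  chain-length2⇒TD3 : ChainPartition E 2 → HasTDColoring E 3
  chain-length2⇒TD3 P =
    c , joined-classes⇒IsTDColoring E (bipartite-proper E f g f≢g)
          (# 2) (# 1) (inj₂ y⊥ , cong colourʸ x⊥y⊥) N[x⊥]-joined
                      (inj₁ (rep (# 1)) , cong inject₁ (cls-rep (# 1))) top-joined
    where
    open ChainPartitionProperties no-isolated P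
    colourʸ : Bool → Fin 3
    colourʸ true  = # 2
    colourʸ false = # 0
    colourʸ≡2⇒true : ∀ {b} → colourʸ b ≡ # 2 → b ≡ true
    colourʸ≡2⇒true {true} _ = refl
    colourʸ≢1 : ∀ {b} → colourʸ b ≢ # 1
    colourʸ≢1 {true}  ()
    colourʸ≢1 {false} ()
    f : Fin n₁ → Fin 3
    f x = inject₁ (cls x)
    g : Fin n₂ → Fin 3
    g y = colourʸ (E x⊥ y)
    c : V E → Fin 3
    c = [ f , g ]
    f≢g : ∀ x y → E x y ≡ true → f x ≢ g y
    f≢g x y xy with E x⊥ y in x⊥y
    ... | true  = fromℕ≢inject₁ ∘ sym
    ... | false = λ fx≡0 →
      not-¬ (cls≡⇒⊆ (trans (inject₁-injective fx≡0) (sym (cls-rep fzero))) y xy) x⊥y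
    N[x⊥]-joined : ∀ u → c u ≡ # 2 → ∀ x → Adj E (inj₁ x) u
    N[x⊥]-joined (inj₁ x′) fx′≡2 = ⊥-elim (fromℕ≢inject₁ (sym fx′≡2))
    N[x⊥]-joined (inj₂ y)  gy≡2  = bottom-neighbours-universal (colourʸ≡2⇒true {E x⊥ y} gy≡2)
    top-joined : ∀ u → c u ≡ # 1 → ∀ y → Adj E (inj₂ y) u
    top-joined (inj₁ x)  fx≡1  = top-universal (inject₁-injective fx≡1)
    top-joined (inj₂ y′) gy′≡1 = ⊥-elim (colourʸ≢1 {E x⊥ y′} gy′≡1)

  chain-length≥2⇒¬TD2 : ∀ {k} → ChainPartition E (2 + k) → ¬ HasTDColoring E 2
  chain-length≥2⇒¬TD2 P =
    let (_ , x₁y₁ , ¬x₀y₁) = rep-⊉ {fzero} {fsuc fzero} (s≤s z≤n)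
    in  private-neighbour⇒¬TD2 E x₁y₁ ¬x₀y₁
    where open ChainPartitionProperties no-isolated P

  chain-length≥3⇒¬TD3 : ∀ {k} → ChainPartition E (3 + k) → ¬ HasTDColoring E 3
  chain-length≥3⇒¬TD3 P =
    let (_ , x₁y₁ , ¬x₀y₁) = rep-⊉ {fzero} {fsuc fzero} (s≤s z≤n)
        (_ , _ , ¬x₁y₂)    = rep-⊉ {fsuc fzero} {fsuc (fsuc fzero)} (s≤s (s≤s z≤n))
    in  private-neighbour∧non-neighbour⇒¬TD3 E x₁y₁ ¬x₀y₁ ¬x₁y₂
    where open ChainPartitionProperties no-isolated P

  χtd≡chain-χtd : ∀ {k} → ChainPartition E k → χtd≡ E (chain-χtd k)
  χtd≡chain-χtd {zero}              P = chain-length0⇒TD0 P , λ _ ()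
  χtd≡chain-χtd {suc zero}          P =
    χtd≡-intro E (chain-length1⇒TD2 P) (ChainPartitionProperties.¬TD1 no-isolated P)
  χtd≡chain-χtd {suc (suc zero)}    P =
    χtd≡-intro E (chain-length2⇒TD3 P) (chain-length≥2⇒¬TD2 P)
  χtd≡chain-χtd {suc (suc (suc _))} P =
    χtd≡-intro E (ChainPartitionProperties.TD4 no-isolated P) (chain-length≥3⇒¬TD3 P)

theorem7 : (n₁ n₂ : ℕ) (E : BipGraph n₁ n₂) → IsChainGraph E → NoIsolated E →
    (k : ℕ) → ChainPartition E k →
    (χtd≡ E 2 ⇔ k ≡ 1) × (χtd≡ E 3 ⇔ k ≡ 2) × (χtd≡ E 4 ⇔ 3 ≤ k)
theorem7 n₁ n₂ E _ no-isolated k P =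
  ⇔-trans (χtd≡⇔ 2) (chain-χtd≡2⇔ k) ,
  ⇔-trans (χtd≡⇔ 3) (chain-χtd≡3⇔ k) ,
  ⇔-trans (χtd≡⇔ 4) (chain-χtd≡4⇔ k)
  where
  χtd≡⇔ : ∀ m → χtd≡ E m ⇔ chain-χtd k ≡ m
  χtd≡⇔ m = mk⇔ (χtd≡-unique E (χtd≡chain-χtd no-isolated P))
                 (λ { refl → χtd≡chain-χtd no-isolated P })
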